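{- Let $X$ and $Y$ be digraphs, each of which is a disjoint union of paths. If $U_X=U_Y$, then $X$ and $Y$ are isomorphic.
   Context: A digraph $X=(V,E)$ has a finite vertex set $V$, $|V|=n$, and $E\subseteq V\times V$. $X$ is a disjoint union of paths if $V$ is partitioned into sequences $(w_1,\dots,w_r)$, $r\ge1$, such that $E$ consists exactly of the edges $(w_i,w_{i+1})$ along these sequences. Two digraphs are isomorphic if there is a vertex bijection $f$ with $(u,v)\in E\iff(f(u),f(v))\in E'$. A $V$-listing is a bijection $\pi:[n]\to V$, and $X\mathrm{Des}(\pi)=\{i\in[n-1]:(\pi_i,\pi_{i+1})\in E\}$. Let $F_I=\sum_{i_1\le\dots\le i_n,\ i_j<i_{j+1}\ (j\in I)}x_{i_1}\cdots x_{i_n}$, and $U_X=\sum_\pi F_{X\mathrm{Des}(\pi)}$ over all $V$-listings. -}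

module Defs where

open import Data.Nat using (ℕ; zero; suc; _<ᵇ_; _≤_; _≡ᵇ_)
open import Data.Bool using (Bool; true; false; _∧_; _∨_; not; if_then_else_)
open import Data.Fin using (Fin)
open import Data.Fin.Properties using (_≟_)
open import Data.List using (List; []; _∷_; _++_; length; concat; map; concatMap; filter; allFin)
open import Data.List.Relation.Unary.All using (All)
open import Data.List.Relation.Binary.Permutation.Propositional using (_↭_)
open import Data.Product using (Σ; ∃; _×_; _,_)
open import Data.List.Membership.Propositional using (_∈_)
open import Relation.Binary.PropositionalEquality using (_≡_)
open import Relation.Nullary.Decidable using (⌊_⌋)
open import Function.Bundles using (_⤖_; Bijection)
open import Function.Base using (_$_)

Digraph : ℕ → Set
Digraph n = Fin n → Fin n → Bool

Consecutive : ∀ {n} → Fin n → Fin n → List (Fin n) → Set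
Consecutive a b p = ∃ λ xs → ∃ λ ys → p ≡ xs ++ (a ∷ b ∷ ys)

NonEmpty : ∀ {A : Set} → List A → Set
NonEmpty xs = ∃ λ y → ∃ λ ys → xs ≡ y ∷ ys

-- X is a disjoint union of paths: V is partitioned into nonempty sequences
-- (their concatenation is a rearrangement of all vertices, each exactly once)
-- and E consists exactly of the edges between consecutive entries.
IsDisjointUnionOfPaths : ∀ {n} → Digraph n → Set
IsDisjointUnionOfPaths {n} E =
  Σ (List (List (Fin n))) λ ps →
    All NonEmpty ps ×
    (concat ps ↭ allFin n) ×
    (∀ a b → E a b ≡ true → Σ (List (Fin n)) λ p → (p ∈ ps) × Consecutive a b p) ×
    (∀ a b → (Σ (List (Fin n)) λ p → (p ∈ ps) × Consecutive a b p) → E a b ≡ true)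

Isomorphic : ∀ {n m} → Digraph n → Digraph m → Set
Isomorphic {n} {m} E E' =
  Σ (Fin n ⤖ Fin m) λ f → ∀ u v → E u v ≡ E' (Bijection.to f u) (Bijection.to f v)

allLists : (n k : ℕ) → List (List (Fin n))
allLists n zero = [] ∷ []
allLists n (suc k) = concatMap (λ a → map (a ∷_) (allLists n k)) (allFin n)

elemᵇ : ∀ {n} → Fin n → List (Fin n) → Bool
elemᵇ a [] = false
elemᵇ a (b ∷ bs) = ⌊ a ≟ b ⌋ ∨ elemᵇ a bs

noDup : ∀ {n} → List (Fin n) → Bool
noDup [] = true
noDup (a ∷ as) = not (elemᵇ a as) ∧ noDup as

-- a V-listing (bijection [n] → V) given as the sequence (π_1, …, π_n):
-- a length-n list over Fin n without repetitions.
IsListingᵇ : ∀ {n} → List (Fin n) → Bool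
IsListingᵇ {n} v = (length v ≡ᵇ n) ∧ noDup v

-- For a listing π and an index sequence (i_1,…,i_n):
-- i_j < i_{j+1} for every j ∈ XDes(π).
compatible : ∀ {n} → Digraph n → List (Fin n) → List ℕ → Bool
compatible E (a ∷ b ∷ vs) (i ∷ j ∷ is) =
  (not (E a b) ∨ (i <ᵇ j)) ∧ compatible E (b ∷ vs) (j ∷ is)
compatible E _ _ = true

count : ∀ {A : Set} → (A → Bool) → List A → ℕ
count p [] = 0
count p (x ∷ xs) = if p x then suc (count p xs) else count p xs

data WeaklyIncreasing : List ℕ → Set where
  wi-[] : WeaklyIncreasing []
  wi-[-] : ∀ {i} → WeaklyIncreasing (i ∷ [])
  wi-∷ : ∀ {i j is} → i ≤ j → WeaklyIncreasing (j ∷ is) → WeaklyIncreasing (i ∷ j ∷ is)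

-- Every monomial x_{i_1} ⋯ x_{i_k} (variables indexed by ℕ) is uniquely written
-- with i_1 ≤ … ≤ i_k.  The coefficient of that monomial in F_I is 1 iff k = n and
-- i_j < i_{j+1} for all j ∈ I, and 0 otherwise.  Hence the coefficient of the
-- monomial in U_X = Σ_π F_{XDes(π)} is:
coeffU : ∀ {n} → Digraph n → List ℕ → ℕ
coeffU {n} E m =
  if length m ≡ᵇ n
  then count (λ v → IsListingᵇ v ∧ compatible E v m) (allLists n n)
  else 0

-- U_X = U_Y as formal power series: equal coefficients at every monomial.
SameU : ∀ {n m} → Digraph n → Digraph m → Set
SameU E E' = ∀ (mono : List ℕ) → WeaklyIncreasing mono → coeffU E mono ≡ coeffU E' mono

module Submission where

-- Reading off coefficients, U_X counts the listings of X with non-edges at prescribed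
-- positions and no condition elsewhere; by inclusion–exclusion (no condition = edge +
-- non-edge) it also counts the listings whose first j+1 entries form a path, which are
-- (number of j-edge paths) · (n − j − 1)! many.  So U_X determines n and the number of
-- j-edge paths for every j.  If X is a disjoint union of paths on l₁, …, l_r vertices, that
-- number is Σ (lᵢ ∸ j); these truncated sums determine the multiset {l₁, …, l_r}, and
-- hence X up to isomorphism.

open import Defs
open import Algebra.Properties.CommutativeSemigroup using (interchange)
open import Data.Bool using (Bool; true; false; _∧_; _∨_; not; if_then_else_; T)
open import Data.Bool.Properties using (∧-zeroʳ; ∧-comm; ∨-zeroʳ; ∨-identityʳ; ∨-assoc)
open import Data.Empty using (⊥-elim)
open import Data.Fin using (Fin) renaming (zero to fzero; suc to fsuc)
open import Data.Fin.Properties using (_≟_) renaming (suc-injective to fsuc-injective)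
open import Data.List using (List; []; _∷_; _++_; [_]; length; concat; map; concatMap; allFin; replicate)
open import Data.List.Extrema.Nat using (max; argmax-sel; v≤max⁺; xs≤max)
open import Data.List.Membership.Propositional using (_∈_; _∉_)
open import Data.List.Membership.Propositional.Properties using (∈-insert; ∈-concat⁺′; ∈-++⁺ˡ; ∈-∃++; ∈-map⁺; ∈-allFin)
open import Data.List.Properties
  using ( map-++; map-cong; map-cong-local; map-∘; map-id; map-tabulate; map-replicate
        ; length-map; length-tabulate; length-++; length-replicate; concat-map
        ; ++-assoc; ++-identityʳ; ∷-injective; ∷-injectiveˡ; ∷-injectiveʳ )
open import Data.List.Relation.Binary.Disjoint.Propositional using (Disjoint)
open import Data.List.Relation.Binary.Permutation.Propositional as Perm using (_↭_; ↭-refl; ↭-prep; ↭-sym; ↭-trans; ↭⇒↭ₛ)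
import Data.List.Relation.Binary.Permutation.Propositional.Properties as ↭
import Data.List.Relation.Binary.Permutation.Setoid.Properties as PermutationSetoid
open import Data.List.Relation.Unary.All as All using (All; []; _∷_)
import Data.List.Relation.Unary.All.Properties as All
open import Data.List.Relation.Unary.AllPairs using ([]; _∷_)
open import Data.List.Relation.Unary.Any using (here; there)
open import Data.List.Relation.Unary.Unique.Propositional using (Unique)
open import Data.List.Relation.Unary.Unique.Propositional.Properties using (Unique[x∷xs]⇒x∉xs; allFin⁺)
import Data.Nat as ℕ
open import Data.Nat using (ℕ; zero; suc; _+_; _*_; _∸_; _≤_; _<_; _<ᵇ_; _≡ᵇ_; _≤?_; s≤s; z<s; _!; ≢-nonZero⁻¹)
open import Data.Nat.ListAction using (sum)
open import Data.Nat.ListAction.Properties using (sum-++; sum-↭)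
open import Data.Nat.Properties
  using ( +-assoc; +-comm; +-identityʳ; +-suc; +-cancelˡ-≡; +-cancelʳ-≡; +-commutativeSemigroup
        ; *-distribʳ-+; *-cancelʳ-≡; suc-injective; ≡ᵇ⇒≡; _!≢0
        ; ≤-refl; ≤-trans; ≤-antisym; ≤-pred; ≰⇒>; <⇒≱; n≤1+n; m≤m+n; m≤n+m; m<m+n
        ; m≤n⇒m∸n≡0; m∸n≡0⇒m≤n; m+n≡0⇒m≡0; m+n≡0⇒n≡0; m+[n∸m]≡n )
open import Data.Product using (Σ; ∃; _×_; _,_; proj₁; proj₂)
open import Data.Sum using (inj₁; inj₂)
open import Data.Unit using (tt)
open import Function.Base using (_∘_; id)
open import Function.Bundles using (mk↔ₛ′)
open import Function.Properties.Inverse using (↔⇒⤖)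
open import Relation.Binary.PropositionalEquality
  using (_≡_; refl; sym; trans; cong; cong₂; subst; subst₂; setoid; module ≡-Reasoning)
open import Relation.Nullary using (¬_; yes; no)
open import Relation.Nullary.Decidable using (⌊_⌋; isYes≗does; dec-true; dec-false)

private
  variable
    A B : Set
    n : ℕ

𝟙 : Bool → ℕ
𝟙 b = if b then 1 else 0

∑ : (A → ℕ) → List A → ℕ
∑ f xs = sum (map f xs)

∑-cong : {f g : A → ℕ} → (∀ x → f x ≡ g x) → ∀ xs → ∑ f xs ≡ ∑ g xs
∑-cong f≗g xs = cong sum (map-cong f≗g xs)

∑-cong-∈ : {f g : A → ℕ} (xs : List A) → (∀ {x} → x ∈ xs → f x ≡ g x) → ∑ f xs ≡ ∑ g xs
∑-cong-∈ xs f≗g = cong sum (map-cong-local (All.tabulate f≗g))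

∑-++ : (f : A → ℕ) (xs ys : List A) → ∑ f (xs ++ ys) ≡ ∑ f xs + ∑ f ys
∑-++ f xs ys = trans (cong sum (map-++ f xs ys)) (sum-++ (map f xs) (map f ys))

∑-map : (f : B → ℕ) (g : A → B) (xs : List A) → ∑ f (map g xs) ≡ ∑ (f ∘ g) xs
∑-map f g xs = cong sum (sym (map-∘ xs))

∑-concat : (f : A → ℕ) (xss : List (List A)) → ∑ f (concat xss) ≡ ∑ (∑ f) xss
∑-concat f [] = refl
∑-concat f (xs ∷ xss) = trans (∑-++ f xs (concat xss)) (cong (∑ f xs +_) (∑-concat f xss))

∑-concatMap : (f : B → ℕ) (g : A → List B) (xs : List A) → ∑ f (concatMap g xs) ≡ ∑ (∑ f ∘ g) xs
∑-concatMap f g xs = trans (∑-concat f (map g xs)) (∑-map (∑ f) g xs)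

∑-↭ : (f : A → ℕ) {xs ys : List A} → xs ↭ ys → ∑ f xs ≡ ∑ f ys
∑-↭ f p = sum-↭ (↭.map⁺ f p)

∑-+ : (f g : A → ℕ) (xs : List A) → ∑ (λ x → f x + g x) xs ≡ ∑ f xs + ∑ g xs
∑-+ f g [] = refl
∑-+ f g (x ∷ xs) = trans (cong ((f x + g x) +_) (∑-+ f g xs)) (interchange +-commutativeSemigroup (f x) (g x) (∑ f xs) (∑ g xs))

∑-*ʳ : (f : A → ℕ) (c : ℕ) (xs : List A) → ∑ (λ x → f x * c) xs ≡ ∑ f xs * c
∑-*ʳ f c [] = refl
∑-*ʳ f c (x ∷ xs) = trans (cong (f x * c +_) (∑-*ʳ f c xs)) (sym (*-distribʳ-+ c (f x) (∑ f xs)))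

∑-zero : {f : A → ℕ} → (∀ x → f x ≡ 0) → ∀ xs → ∑ f xs ≡ 0
∑-zero f≡0 [] = refl
∑-zero f≡0 (x ∷ xs) = cong₂ _+_ (f≡0 x) (∑-zero f≡0 xs)

∑-const-1 : (xs : List A) → ∑ (λ _ → 1) xs ≡ length xs
∑-const-1 [] = refl
∑-const-1 (x ∷ xs) = cong suc (∑-const-1 xs)

∑-allFin-suc : (f : Fin (suc n) → ℕ) → ∑ f (allFin (suc n)) ≡ f fzero + ∑ (f ∘ fsuc) (allFin n)
∑-allFin-suc {n} f = cong (f fzero +_) (trans (cong (∑ f) (sym (map-tabulate id fsuc))) (∑-map f fsuc (allFin n)))

∑-allFin-single : (f : Fin n → ℕ) (x : Fin n) → (∀ y → ¬ y ≡ x → f y ≡ 0) → ∑ f (allFin n) ≡ f x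
∑-allFin-single {suc n} f fzero f≡0 = trans (∑-allFin-suc f)
  (trans (cong (f fzero +_) (∑-zero (λ y → f≡0 (fsuc y) λ ()) (allFin n))) (+-identityʳ _))
∑-allFin-single {suc n} f (fsuc x) f≡0 = trans (∑-allFin-suc f)
  (cong₂ _+_ (f≡0 fzero λ ()) (∑-allFin-single (f ∘ fsuc) x (λ y y≢x → f≡0 (fsuc y) (y≢x ∘ fsuc-injective))))

count≡∑ : (p : A → Bool) (xs : List A) → count p xs ≡ ∑ (𝟙 ∘ p) xs
count≡∑ p [] = refl
count≡∑ p (x ∷ xs) with p x
... | true = cong suc (count≡∑ p xs)
... | false = count≡∑ p xs

∑-allLists-suc : (f : List (Fin n) → ℕ) (k : ℕ) →
  ∑ f (allLists n (suc k)) ≡ ∑ (λ a → ∑ (λ u → f (a ∷ u)) (allLists n k)) (allFin n)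
∑-allLists-suc {n} f k = trans (∑-concatMap f _ (allFin n)) (∑-cong (λ a → ∑-map f (a ∷_) (allLists n k)) (allFin n))

∑-allLists-+ : (f : List (Fin n) → ℕ) (k l : ℕ) →
  ∑ f (allLists n (k + l)) ≡ ∑ (λ u → ∑ (λ w → f (u ++ w)) (allLists n l)) (allLists n k)
∑-allLists-+ f zero l = sym (+-identityʳ _)
∑-allLists-+ {n} f (suc k) l = begin
  ∑ f (allLists n (suc k + l))                                   ≡⟨ ∑-allLists-suc f (k + l) ⟩
  ∑ (λ a → ∑ (λ v → f (a ∷ v)) (allLists n (k + l))) (allFin n)
    ≡⟨ ∑-cong (λ a → ∑-allLists-+ (f ∘ (a ∷_)) k l) (allFin n) ⟩
  ∑ (λ a → ∑ (λ u → g (a ∷ u)) (allLists n k)) (allFin n)        ≡⟨ sym (∑-allLists-suc g k) ⟩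
  ∑ g (allLists n (suc k))                                       ∎
  where
  open ≡-Reasoning
  g : List (Fin n) → ℕ
  g u = ∑ (λ w → f (u ++ w)) (allLists n l)

∑-cong-allLists : {f g : List (Fin n) → ℕ} (k : ℕ) → (∀ u → length u ≡ k → f u ≡ g u) →
  ∑ f (allLists n k) ≡ ∑ g (allLists n k)
∑-cong-allLists zero f≗g = cong (_+ 0) (f≗g [] refl)
∑-cong-allLists {n} {f} {g} (suc k) f≗g = begin
  ∑ f (allLists n (suc k))                                 ≡⟨ ∑-allLists-suc f k ⟩
  ∑ (λ a → ∑ (λ u → f (a ∷ u)) (allLists n k)) (allFin n)
    ≡⟨ ∑-cong (λ a → ∑-cong-allLists k (λ u eq → f≗g (a ∷ u) (cong suc eq))) (allFin n) ⟩
  ∑ (λ a → ∑ (λ u → g (a ∷ u)) (allLists n k)) (allFin n) ≡⟨ sym (∑-allLists-suc g k) ⟩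
  ∑ g (allLists n (suc k))                                 ∎
  where open ≡-Reasoning

⌊≟⌋-refl : (a : Fin n) → ⌊ a ≟ a ⌋ ≡ true
⌊≟⌋-refl a = trans (isYes≗does (a ≟ a)) (dec-true (a ≟ a) refl)

⌊≟⌋-≢ : {a b : Fin n} → ¬ a ≡ b → ⌊ a ≟ b ⌋ ≡ false
⌊≟⌋-≢ {a = a} {b} a≢b = trans (isYes≗does (a ≟ b)) (dec-false (a ≟ b) a≢b)

<ᵇ-suc : (i : ℕ) → (i <ᵇ suc i) ≡ true
<ᵇ-suc zero = refl
<ᵇ-suc (suc i) = <ᵇ-suc i

<ᵇ-irrefl : (i : ℕ) → (i <ᵇ i) ≡ false
<ᵇ-irrefl zero = refl
<ᵇ-irrefl (suc i) = <ᵇ-irrefl i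

≡ᵇ-refl : (k : ℕ) → (k ≡ᵇ k) ≡ true
≡ᵇ-refl zero = refl
≡ᵇ-refl (suc k) = ≡ᵇ-refl k

∧-≡-true : {b c : Bool} → b ∧ c ≡ true → b ≡ true × c ≡ true
∧-≡-true {true} {true} _ = refl , refl

true⇔true⇒≡ : {b c : Bool} → (b ≡ true → c ≡ true) → (c ≡ true → b ≡ true) → b ≡ c
true⇔true⇒≡ {true} {true} _ _ = refl
true⇔true⇒≡ {false} {false} _ _ = refl
true⇔true⇒≡ {true} {false} b⇒c _ = sym (b⇒c refl)
true⇔true⇒≡ {false} {true} _ c⇒b = c⇒b refl

replicate-suc-++ : (j : ℕ) (x : A) (xs : List A) → replicate (suc j) x ++ xs ≡ replicate j x ++ x ∷ xs
replicate-suc-++ zero x xs = refl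
replicate-suc-++ (suc j) x xs = cong (x ∷_) (replicate-suc-++ j x xs)

length-concat : (xss : List (List A)) → length (concat xss) ≡ sum (map length xss)
length-concat [] = refl
length-concat (xs ∷ xss) = trans (length-++ xs) (cong (length xs +_) (length-concat xss))

∈⇒↭∷ : {x : A} {xs : List A} → x ∈ xs → ∃ λ ys → xs ↭ x ∷ ys
∈⇒↭∷ {x = x} x∈xs with ∈-∃++ x∈xs
... | ys , zs , refl = ys ++ zs , ↭.shift x ys zs

concat-↭ : {xss yss : List (List A)} → xss ↭ yss → concat xss ↭ concat yss
concat-↭ Perm.refl = ↭-refl
concat-↭ (Perm.prep xs p) = ↭.++⁺ˡ xs (concat-↭ p)
concat-↭ (Perm.swap xs ys p) = ↭-trans (↭.shifts xs ys) (↭.++⁺ˡ ys (↭.++⁺ˡ xs (concat-↭ p)))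
concat-↭ (Perm.trans p q) = ↭-trans (concat-↭ p) (concat-↭ q)

++-injective-length : (xs ys : List A) {zs ws : List A} → length xs ≡ length ys → xs ++ zs ≡ ys ++ ws → xs ≡ ys × zs ≡ ws
++-injective-length [] [] _ eq = refl , eq
++-injective-length (x ∷ xs) (y ∷ ys) len eq with ∷-injective eq
... | refl , eq′ with ++-injective-length xs ys (suc-injective len) eq′
... | refl , zs≡ws = refl , zs≡ws

concat-injective : (xss yss : List (List A)) → map length xss ≡ map length yss → concat xss ≡ concat yss → xss ≡ yss
concat-injective [] [] _ _ = refl
concat-injective (xs ∷ xss) (ys ∷ yss) lens eq with ++-injective-length xs ys (∷-injectiveˡ lens) eq
... | refl , eq′ = cong (xs ∷_) (concat-injective xss yss (∷-injectiveʳ lens) eq′)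

map-inverse : {f : A → B} {g : B → A} → (∀ x → g (f x) ≡ x) → ∀ xs → map g (map f xs) ≡ xs
map-inverse g∘f xs = trans (sym (map-∘ xs)) (trans (map-cong g∘f xs) (map-id xs))

Unique-resp-↭ : {xs ys : List A} → xs ↭ ys → Unique xs → Unique ys
Unique-resp-↭ {A} p = PermutationSetoid.Unique-resp-↭ (setoid A) (↭⇒↭ₛ p)

Unique-++⁻ : (xs : List A) {ys : List A} → Unique (xs ++ ys) → Unique xs × Unique ys × Disjoint xs ys
Unique-++⁻ [] u = [] , u , λ ()
Unique-++⁻ (x ∷ xs) (x∉xs++ys ∷ u) with Unique-++⁻ xs u
... | u-xs , u-ys , xs#ys = All.++⁻ˡ xs x∉xs++ys ∷ u-xs , u-ys , x∷xs#ys
  where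
  x∷xs#ys : Disjoint (x ∷ xs) _
  x∷xs#ys (here refl , v∈ys) = All.lookup (All.++⁻ʳ xs x∉xs++ys) v∈ys refl
  x∷xs#ys (there v∈xs , v∈ys) = xs#ys (v∈xs , v∈ys)

Unique-concat-∈ : {qs : List (List A)} {q : List A} → Unique (concat qs) → q ∈ qs → Unique q
Unique-concat-∈ {qs = q ∷ _} u (here refl) = proj₁ (Unique-++⁻ q u)
Unique-concat-∈ {qs = q ∷ _} u (there q∈qs) = Unique-concat-∈ (proj₁ (proj₂ (Unique-++⁻ q u))) q∈qs

Unique-concat-shared : {qs : List (List A)} {q q′ : List A} {a : A} → Unique (concat qs) →
  q ∈ qs → q′ ∈ qs → a ∈ q → a ∈ q′ → q ≡ q′
Unique-concat-shared {qs = q ∷ _} u (here refl) (here refl) _ _ = refl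
Unique-concat-shared {qs = q ∷ _} u (here refl) (there q′∈qs) a∈q a∈q′ =
  ⊥-elim (proj₂ (proj₂ (Unique-++⁻ q u)) (a∈q , ∈-concat⁺′ a∈q′ q′∈qs))
Unique-concat-shared {qs = q ∷ _} u (there q∈qs) (here refl) a∈q a∈q′ =
  ⊥-elim (proj₂ (proj₂ (Unique-++⁻ q u)) (a∈q′ , ∈-concat⁺′ a∈q q∈qs))
Unique-concat-shared {qs = q ∷ _} u (there q∈qs) (there q′∈qs) a∈q a∈q′ =
  Unique-concat-shared (proj₁ (proj₂ (Unique-++⁻ q u))) q∈qs q′∈qs a∈q a∈q′

Unique-suffix : (xs xs′ : List A) {a : A} {r r′ : List A} →
  Unique (xs ++ a ∷ r) → xs ++ a ∷ r ≡ xs′ ++ a ∷ r′ → r ≡ r′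
Unique-suffix [] [] u eq = ∷-injectiveʳ eq
Unique-suffix [] (y ∷ ys) {r′ = r′} u eq with ∷-injective eq
... | refl , r≡ = ⊥-elim (Unique[x∷xs]⇒x∉xs u (subst (_ ∈_) (sym r≡) (∈-insert ys)))
Unique-suffix (x ∷ xs) [] u eq with ∷-injective eq
... | refl , _ = ⊥-elim (Unique[x∷xs]⇒x∉xs u (∈-insert xs))
Unique-suffix (x ∷ xs) (y ∷ ys) (_ ∷ u) eq = Unique-suffix xs ys u (∷-injectiveʳ eq)

elemᵇ-++ : (a : Fin n) (xs ys : List (Fin n)) → elemᵇ a (xs ++ ys) ≡ elemᵇ a xs ∨ elemᵇ a ys
elemᵇ-++ a [] ys = refl
elemᵇ-++ a (x ∷ xs) ys = trans (cong (⌊ a ≟ x ⌋ ∨_) (elemᵇ-++ a xs ys)) (sym (∨-assoc ⌊ a ≟ x ⌋ _ _))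

∉⇒elemᵇ-false : {a : Fin n} (xs : List (Fin n)) → a ∉ xs → elemᵇ a xs ≡ false
∉⇒elemᵇ-false [] _ = refl
∉⇒elemᵇ-false (x ∷ xs) a∉x∷xs rewrite ⌊≟⌋-≢ (a∉x∷xs ∘ here) = ∉⇒elemᵇ-false xs (a∉x∷xs ∘ there)

noDup-∷-true : {a : Fin n} {xs : List (Fin n)} → noDup (a ∷ xs) ≡ true → elemᵇ a xs ≡ false × noDup xs ≡ true
noDup-∷-true {a = a} {xs} h with elemᵇ a xs | noDup xs
... | false | true = refl , refl

noDup-++-false : (u w : List (Fin n)) → noDup u ≡ false → noDup (u ++ w) ≡ false
noDup-++-false (a ∷ u) w h with elemᵇ a u in a∈u
... | true rewrite elemᵇ-++ a u w | a∈u = refl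
... | false = trans (cong (not (elemᵇ a (u ++ w)) ∧_) (noDup-++-false u w h)) (∧-zeroʳ _)

noDup-∷ʳ : (S : List (Fin n)) (a : Fin n) → noDup S ≡ true → elemᵇ a S ≡ false → noDup (S ++ [ a ]) ≡ true
noDup-∷ʳ [] a _ _ = refl
noDup-∷ʳ (x ∷ S) a h a∉S with a ≟ x | noDup-∷-true {a = x} {S} h
noDup-∷ʳ (x ∷ S) a h () | yes refl | _
... | no a≢x | x∉S , S-nodup rewrite elemᵇ-++ x S [ a ] | x∉S | ⌊≟⌋-≢ (a≢x ∘ sym) = noDup-∷ʳ S a S-nodup a∉S

noDup-∷ʳ-false : (S : List (Fin n)) (a : Fin n) → elemᵇ a S ≡ true → noDup (S ++ [ a ]) ≡ false
noDup-∷ʳ-false (x ∷ S) a a∈xS with a ≟ x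
... | yes refl rewrite elemᵇ-++ a S [ a ] | ⌊≟⌋-refl a | ∨-zeroʳ (elemᵇ a S) = refl
... | no _ = trans (cong (not (elemᵇ x (S ++ [ a ])) ∧_) (noDup-∷ʳ-false S a a∈xS)) (∧-zeroʳ _)

∑-elemᵇ : (S : List (Fin n)) → noDup S ≡ true → ∑ (λ a → 𝟙 (elemᵇ a S)) (allFin n) ≡ length S
∑-elemᵇ {n} [] _ = ∑-zero (λ _ → refl) (allFin n)
∑-elemᵇ {n} (x ∷ S) h = begin
  ∑ (λ a → 𝟙 (⌊ a ≟ x ⌋ ∨ elemᵇ a S)) (allFin n)                   ≡⟨ ∑-cong split (allFin n) ⟩
  ∑ (λ a → 𝟙 ⌊ a ≟ x ⌋ + 𝟙 (elemᵇ a S)) (allFin n)                 ≡⟨ ∑-+ _ _ (allFin n) ⟩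
  ∑ (λ a → 𝟙 ⌊ a ≟ x ⌋) (allFin n) + ∑ (λ a → 𝟙 (elemᵇ a S)) (allFin n)
    ≡⟨ cong₂ _+_ (∑-allFin-single _ x (λ y y≢x → cong 𝟙 (⌊≟⌋-≢ y≢x))) (∑-elemᵇ S S-nodup) ⟩
  𝟙 ⌊ x ≟ x ⌋ + length S
    ≡⟨ cong (λ b → 𝟙 b + length S) (⌊≟⌋-refl x) ⟩
  suc (length S)                                                   ∎
  where
  open ≡-Reasoning
  x∉S : elemᵇ x S ≡ false
  x∉S = proj₁ (noDup-∷-true {a = x} {S} h)
  S-nodup : noDup S ≡ true
  S-nodup = proj₂ (noDup-∷-true {a = x} {S} h)
  split : ∀ a → 𝟙 (⌊ a ≟ x ⌋ ∨ elemᵇ a S) ≡ 𝟙 ⌊ a ≟ x ⌋ + 𝟙 (elemᵇ a S)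
  split a with a ≟ x
  ... | yes refl rewrite x∉S = refl
  ... | no _ = refl

∑-notElemᵇ : (S : List (Fin n)) → noDup S ≡ true → ∑ (λ a → 𝟙 (not (elemᵇ a S))) (allFin n) + length S ≡ n
∑-notElemᵇ {n} S h = begin
  ∑ (λ a → 𝟙 (not (elemᵇ a S))) (allFin n) + length S
    ≡⟨ cong (∑ (λ a → 𝟙 (not (elemᵇ a S))) (allFin n) +_) (sym (∑-elemᵇ S h)) ⟩
  ∑ (λ a → 𝟙 (not (elemᵇ a S))) (allFin n) + ∑ (λ a → 𝟙 (elemᵇ a S)) (allFin n)
    ≡⟨ sym (∑-+ _ _ (allFin n)) ⟩
  ∑ (λ a → 𝟙 (not (elemᵇ a S)) + 𝟙 (elemᵇ a S)) (allFin n)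
    ≡⟨ ∑-cong (λ a → 𝟙-not+𝟙 (elemᵇ a S)) (allFin n) ⟩
  ∑ (λ _ → 1) (allFin n)
    ≡⟨ trans (∑-const-1 (allFin n)) (length-tabulate id) ⟩
  n ∎
  where
  open ≡-Reasoning
  𝟙-not+𝟙 : ∀ b → 𝟙 (not b) + 𝟙 b ≡ 1
  𝟙-not+𝟙 true = refl
  𝟙-not+𝟙 false = refl

∑-noDup-extensions : (r : ℕ) (S : List (Fin n)) → noDup S ≡ true → length S + r ≡ n →
  ∑ (λ w → 𝟙 (noDup (S ++ w))) (allLists n r) ≡ r !
∑-noDup-extensions zero S h e rewrite ++-identityʳ S | h = refl
∑-noDup-extensions {n} (suc r) S h e = begin
  ∑ (λ w → 𝟙 (noDup (S ++ w))) (allLists n (suc r))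
    ≡⟨ ∑-allLists-suc (λ w → 𝟙 (noDup (S ++ w))) r ⟩
  ∑ (λ a → ∑ (λ w → 𝟙 (noDup (S ++ a ∷ w))) (allLists n r)) (allFin n) ≡⟨ ∑-cong extend (allFin n) ⟩
  ∑ (λ a → 𝟙 (not (elemᵇ a S)) * r !) (allFin n)                       ≡⟨ ∑-*ʳ _ (r !) (allFin n) ⟩
  ∑ (λ a → 𝟙 (not (elemᵇ a S))) (allFin n) * r !                       ≡⟨ cong (_* r !) fresh ⟩
  suc r * r !                                                          ∎
  where
  open ≡-Reasoning
  fresh : ∑ (λ a → 𝟙 (not (elemᵇ a S))) (allFin n) ≡ suc r
  fresh = +-cancelʳ-≡ _ _ _ (trans (∑-notElemᵇ {n} S h) (trans (sym e) (+-comm (length S) (suc r))))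
  S∷ʳa++ : ∀ a w → noDup (S ++ a ∷ w) ≡ noDup ((S ++ [ a ]) ++ w)
  S∷ʳa++ a w = cong noDup (sym (++-assoc S [ a ] w))
  extend : ∀ a → ∑ (λ w → 𝟙 (noDup (S ++ a ∷ w))) (allLists n r) ≡ 𝟙 (not (elemᵇ a S)) * r !
  extend a with elemᵇ a S in a∈S
  ... | true = ∑-zero (λ w → cong 𝟙 (trans (S∷ʳa++ a w) (noDup-++-false (S ++ [ a ]) w (noDup-∷ʳ-false S a a∈S))))
                      (allLists n r)
  ... | false = begin
    ∑ (λ w → 𝟙 (noDup (S ++ a ∷ w))) (allLists n r)          ≡⟨ ∑-cong (cong 𝟙 ∘ S∷ʳa++ a) (allLists n r) ⟩
    ∑ (λ w → 𝟙 (noDup ((S ++ [ a ]) ++ w))) (allLists n r)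
      ≡⟨ ∑-noDup-extensions r (S ++ [ a ]) (noDup-∷ʳ S a h a∈S) longer ⟩
    r !                                                      ≡⟨ sym (+-identityʳ _) ⟩
    r ! + 0                                                  ∎
    where
    longer : length (S ++ [ a ]) + r ≡ n
    longer = trans (cong (_+ r) (length-++ S)) (trans (+-assoc (length S) 1 r) e)

-- Coefficients of U as numbers of listings with a prescribed edge pattern

data Constraint : Set where
  free edge nonEdge : Constraint

permits : Constraint → Bool → Bool
permits free _ = true
permits edge e = e
permits nonEdge e = not e

satisfies : Digraph n → List (Fin n) → List Constraint → Bool
satisfies E (a ∷ b ∷ vs) (c ∷ cs) = permits c (E a b) ∧ satisfies E (b ∷ vs) cs
satisfies E _ _ = true

#listings : Digraph n → List Constraint → ℕ
#listings {n} E cs = ∑ (λ v → 𝟙 (IsListingᵇ v ∧ satisfies E v cs)) (allLists n n)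

𝟙-satisfies-free : (E : Digraph n) (v : List (Fin n)) (pre rest : List Constraint) → suc (length pre) < length v →
  𝟙 (satisfies E v (pre ++ free ∷ rest))
    ≡ 𝟙 (satisfies E v (pre ++ edge ∷ rest)) + 𝟙 (satisfies E v (pre ++ nonEdge ∷ rest))
𝟙-satisfies-free E (a ∷ b ∷ vs) [] rest _ with E a b | satisfies E (b ∷ vs) rest
... | true | true = refl
... | true | false = refl
... | false | true = refl
... | false | false = refl
𝟙-satisfies-free E (a ∷ b ∷ vs) (c ∷ pre) rest (s≤s (s≤s pre<vs)) with permits c (E a b)
... | true = 𝟙-satisfies-free E (b ∷ vs) pre rest (s≤s pre<vs)
... | false = refl
𝟙-satisfies-free E (a ∷ []) pre rest (s≤s ())

#listings-free : (E : Digraph n) (pre rest : List Constraint) → suc (length pre) < n →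
  #listings E (pre ++ free ∷ rest) ≡ #listings E (pre ++ edge ∷ rest) + #listings E (pre ++ nonEdge ∷ rest)
#listings-free {n} E pre rest pre<n = trans (∑-cong-allLists n split) (∑-+ _ _ (allLists n n))
  where
  split : ∀ v → length v ≡ n →
    𝟙 (IsListingᵇ v ∧ satisfies E v (pre ++ free ∷ rest))
      ≡ 𝟙 (IsListingᵇ v ∧ satisfies E v (pre ++ edge ∷ rest))
        + 𝟙 (IsListingᵇ v ∧ satisfies E v (pre ++ nonEdge ∷ rest))
  split v len with IsListingᵇ v
  ... | true = 𝟙-satisfies-free E v pre rest (subst (suc (length pre) <_) (sym len) pre<n)
  ... | false = refl

bump : Bool → ℕ → ℕ
bump ascent i = if ascent then suc i else i

ascentsFrom : ℕ → List Bool → List ℕ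
ascentsFrom i [] = []
ascentsFrom i (b ∷ bs) = bump b i ∷ ascentsFrom (bump b i) bs

monomialFrom : ℕ → List Bool → List ℕ
monomialFrom i bs = i ∷ ascentsFrom i bs

monomialFrom-weaklyIncreasing : (i : ℕ) (bs : List Bool) → WeaklyIncreasing (monomialFrom i bs)
monomialFrom-weaklyIncreasing i [] = wi-[-]
monomialFrom-weaklyIncreasing i (b ∷ bs) = wi-∷ (i≤bump b) (monomialFrom-weaklyIncreasing (bump b i) bs)
  where
  i≤bump : ∀ b → i ≤ bump b i
  i≤bump true = n≤1+n i
  i≤bump false = ≤-refl

length-ascentsFrom : (i : ℕ) (bs : List Bool) → length (ascentsFrom i bs) ≡ length bs
length-ascentsFrom i [] = refl
length-ascentsFrom i (b ∷ bs) = cong suc (length-ascentsFrom (bump b i) bs)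

stepConstraint : Bool → Constraint
stepConstraint true = free
stepConstraint false = nonEdge

-- A strict ascent i_j < i_{j+1} leaves (π_j, π_{j+1}) unconstrained; a plateau i_j = i_{j+1} forbids an edge.
compatible-monomialFrom : (E : Digraph n) (v : List (Fin n)) (i : ℕ) (bs : List Bool) →
  compatible E v (monomialFrom i bs) ≡ satisfies E v (map stepConstraint bs)
compatible-monomialFrom E (a ∷ b ∷ vs) i (c ∷ cs) =
  cong₂ _∧_ (step (E a b) c) (compatible-monomialFrom E (b ∷ vs) (bump c i) cs)
  where
  step : ∀ e c → (not e ∨ (i <ᵇ bump c i)) ≡ permits (stepConstraint c) e
  step e true rewrite <ᵇ-suc i = ∨-zeroʳ (not e)
  step e false rewrite <ᵇ-irrefl i = ∨-identityʳ (not e)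
compatible-monomialFrom E [] i bs = refl
compatible-monomialFrom E (a ∷ []) i bs = refl
compatible-monomialFrom E (a ∷ b ∷ vs) i [] = refl

coeffU-monomialFrom : (E : Digraph n) (bs : List Bool) → suc (length bs) ≡ n →
  coeffU E (monomialFrom 0 bs) ≡ #listings E (map stepConstraint bs)
coeffU-monomialFrom {n} E bs refl rewrite length-ascentsFrom 0 bs | ≡ᵇ-refl (length bs) =
  trans (count≡∑ _ (allLists n n))
        (∑-cong (λ v → cong (λ c → 𝟙 (IsListingᵇ v ∧ c)) (compatible-monomialFrom E v 0 bs)) (allLists n n))

-- Inclusion–exclusion: a free position splits as edge + nonEdge, and the free/nonEdge patterns are coefficients of U.
#listings-edgePrefix-sameU : {X Y : Digraph n} → SameU X Y → (j : ℕ) (bs : List Bool) → j + suc (length bs) ≡ n →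
  #listings X (replicate j edge ++ map stepConstraint bs) ≡ #listings Y (replicate j edge ++ map stepConstraint bs)
#listings-edgePrefix-sameU {X = X} {Y} same zero bs len = begin
  #listings X (map stepConstraint bs) ≡⟨ sym (coeffU-monomialFrom X bs len) ⟩
  coeffU X (monomialFrom 0 bs)        ≡⟨ same _ (monomialFrom-weaklyIncreasing 0 bs) ⟩
  coeffU Y (monomialFrom 0 bs)        ≡⟨ coeffU-monomialFrom Y bs len ⟩
  #listings Y (map stepConstraint bs) ∎
  where open ≡-Reasoning
#listings-edgePrefix-sameU {n} {X} {Y} same (suc j) bs len = begin
  #listings X (replicate (suc j) edge ++ cs) ≡⟨ cong (#listings X) (replicate-suc-++ j edge cs) ⟩
  #listings X (pre ++ edge ∷ cs)             ≡⟨ +-cancelʳ-≡ _ _ _ edges+nonEdges ⟩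
  #listings Y (pre ++ edge ∷ cs)             ≡⟨ cong (#listings Y) (sym (replicate-suc-++ j edge cs)) ⟩
  #listings Y (replicate (suc j) edge ++ cs) ∎
  where
  open ≡-Reasoning
  pre = replicate j edge
  cs = map stepConstraint bs
  len′ : j + suc (suc (length bs)) ≡ n
  len′ = trans (+-suc j (suc (length bs))) len
  pre<n : suc (length pre) < n
  pre<n = subst (_< n) (cong suc (sym (length-replicate j))) (subst (suc j <_) len (m<m+n (suc j) z<s))
  edges+nonEdges : #listings X (pre ++ edge ∷ cs) + #listings X (pre ++ nonEdge ∷ cs)
                 ≡ #listings Y (pre ++ edge ∷ cs) + #listings X (pre ++ nonEdge ∷ cs)
  edges+nonEdges = begin
    #listings X (pre ++ edge ∷ cs) + #listings X (pre ++ nonEdge ∷ cs) ≡⟨ sym (#listings-free X pre cs pre<n) ⟩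
    #listings X (pre ++ free ∷ cs)                                    ≡⟨ #listings-edgePrefix-sameU same j (true ∷ bs) len′ ⟩
    #listings Y (pre ++ free ∷ cs)                                    ≡⟨ #listings-free Y pre cs pre<n ⟩
    #listings Y (pre ++ edge ∷ cs) + #listings Y (pre ++ nonEdge ∷ cs)
      ≡⟨ cong (#listings Y (pre ++ edge ∷ cs) +_) (sym (#listings-edgePrefix-sameU same j (false ∷ bs) len′)) ⟩
    #listings Y (pre ++ edge ∷ cs) + #listings X (pre ++ nonEdge ∷ cs) ∎

IsWalkᵇ : Digraph n → List (Fin n) → Bool
IsWalkᵇ E (a ∷ b ∷ vs) = E a b ∧ IsWalkᵇ E (b ∷ vs)
IsWalkᵇ E _ = true

#paths : Digraph n → ℕ → ℕ
#paths {n} E j = ∑ (λ u → 𝟙 (IsWalkᵇ E u ∧ noDup u)) (allLists n (suc j))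

#paths-zero : (E : Digraph n) → #paths E 0 ≡ n
#paths-zero {n} E =
  trans (∑-allLists-suc (λ u → 𝟙 (IsWalkᵇ E u ∧ noDup u)) 0) (trans (∑-const-1 (allFin n)) (length-tabulate id))

#pathsFrom : Digraph n → ℕ → Fin n → ℕ
#pathsFrom {n} E j a = ∑ (λ u → 𝟙 (IsWalkᵇ E (a ∷ u) ∧ noDup (a ∷ u))) (allLists n j)

#paths≡∑#pathsFrom : (E : Digraph n) (j : ℕ) → #paths E j ≡ ∑ (#pathsFrom E j) (allFin n)
#paths≡∑#pathsFrom E j = ∑-allLists-suc (λ u → 𝟙 (IsWalkᵇ E u ∧ noDup u)) j

satisfies-allFree : (E : Digraph n) (v : List (Fin n)) (r : ℕ) → satisfies E v (replicate r free) ≡ true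
satisfies-allFree E (a ∷ b ∷ vs) (suc r) = satisfies-allFree E (b ∷ vs) r
satisfies-allFree E [] r = refl
satisfies-allFree E (a ∷ []) r = refl
satisfies-allFree E (a ∷ b ∷ vs) zero = refl

satisfies-++-allFree : (E : Digraph n) (v : List (Fin n)) (cs : List Constraint) (r : ℕ) →
  satisfies E v (cs ++ replicate r free) ≡ satisfies E v cs
satisfies-++-allFree E (a ∷ b ∷ vs) (c ∷ cs) r = cong (permits c (E a b) ∧_) (satisfies-++-allFree E (b ∷ vs) cs r)
satisfies-++-allFree E (a ∷ b ∷ vs) [] r = satisfies-allFree E (a ∷ b ∷ vs) r
satisfies-++-allFree E [] cs r = refl
satisfies-++-allFree E (a ∷ []) [] r = refl
satisfies-++-allFree E (a ∷ []) (c ∷ cs) r = refl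

satisfies-edgePrefix : (E : Digraph n) (j : ℕ) (u w : List (Fin n)) → length u ≡ suc j →
  satisfies E (u ++ w) (replicate j edge) ≡ IsWalkᵇ E u
satisfies-edgePrefix E zero (a ∷ []) [] _ = refl
satisfies-edgePrefix E zero (a ∷ []) (b ∷ w) _ = refl
satisfies-edgePrefix E (suc j) (a ∷ b ∷ u) w len = cong (E a b ∧_) (satisfies-edgePrefix E j (b ∷ u) w (suc-injective len))

-- A listing whose first j+1 entries form a path is that path followed by any ordering of the other r vertices.
#listings-edgePrefix : (E : Digraph n) (j r : ℕ) → suc j + r ≡ n →
  #listings E (replicate j edge ++ replicate r free) ≡ #paths E j * r !
#listings-edgePrefix {n} E j r refl = begin
  ∑ (λ v → 𝟙 (IsListingᵇ v ∧ satisfies E v (replicate j edge ++ replicate r free))) (allLists n n)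
    ≡⟨ ∑-cong (λ v → cong (λ c → 𝟙 (IsListingᵇ v ∧ c)) (satisfies-++-allFree E v (replicate j edge) r)) (allLists n n) ⟩
  ∑ (λ v → 𝟙 (IsListingᵇ v ∧ satisfies E v (replicate j edge))) (allLists n (suc j + r))
    ≡⟨ ∑-allLists-+ (λ v → 𝟙 (IsListingᵇ v ∧ satisfies E v (replicate j edge))) (suc j) r ⟩
  ∑ (λ u → ∑ (λ w → 𝟙 (IsListingᵇ (u ++ w) ∧ satisfies E (u ++ w) (replicate j edge))) (allLists n r)) (allLists n (suc j))
    ≡⟨ ∑-cong-allLists (suc j) extensions ⟩
  ∑ (λ u → 𝟙 (IsWalkᵇ E u ∧ noDup u) * r !) (allLists n (suc j))
    ≡⟨ ∑-*ʳ _ (r !) (allLists n (suc j)) ⟩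
  #paths E j * r ! ∎
  where
  open ≡-Reasoning
  extensions : ∀ u → length u ≡ suc j →
    ∑ (λ w → 𝟙 (IsListingᵇ (u ++ w) ∧ satisfies E (u ++ w) (replicate j edge))) (allLists n r)
      ≡ 𝟙 (IsWalkᵇ E u ∧ noDup u) * r !
  extensions u len-u = trans (∑-cong-allLists r listing⇔) by-cases
    where
    listing⇔ : ∀ w → length w ≡ r →
      𝟙 (IsListingᵇ (u ++ w) ∧ satisfies E (u ++ w) (replicate j edge)) ≡ 𝟙 (IsWalkᵇ E u ∧ noDup (u ++ w))
    listing⇔ w len-w rewrite satisfies-edgePrefix E j u w len-u | length-++ u {w} | len-u | len-w | ≡ᵇ-refl (j + r) =
      cong 𝟙 (∧-comm (noDup (u ++ w)) (IsWalkᵇ E u))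
    by-cases : ∑ (λ w → 𝟙 (IsWalkᵇ E u ∧ noDup (u ++ w))) (allLists n r) ≡ 𝟙 (IsWalkᵇ E u ∧ noDup u) * r !
    by-cases with IsWalkᵇ E u | noDup u in u-nodup
    ... | false | _ = ∑-zero (λ _ → refl) (allLists n r)
    ... | true | false = ∑-zero (λ w → cong 𝟙 (noDup-++-false u w u-nodup)) (allLists n r)
    ... | true | true = trans (∑-noDup-extensions r u u-nodup (cong (_+ r) len-u)) (sym (+-identityʳ _))

#paths-sameU : {X Y : Digraph n} → SameU X Y → (j : ℕ) → suc j ≤ n → #paths X j ≡ #paths Y j
#paths-sameU {n} {X} {Y} same j j<n = *-cancelʳ-≡ (#paths X j) (#paths Y j) (r !) {{r !≢0}} (begin
  #paths X j * r !                                         ≡⟨ sym (#listings-edgePrefix X j r len) ⟩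
  #listings X (replicate j edge ++ replicate r free)       ≡⟨ cong (#listings X ∘ (replicate j edge ++_)) free≡ ⟩
  #listings X (replicate j edge ++ map stepConstraint bs)  ≡⟨ #listings-edgePrefix-sameU same j bs len′ ⟩
  #listings Y (replicate j edge ++ map stepConstraint bs)  ≡⟨ cong (#listings Y ∘ (replicate j edge ++_)) (sym free≡) ⟩
  #listings Y (replicate j edge ++ replicate r free)       ≡⟨ #listings-edgePrefix Y j r len ⟩
  #paths Y j * r !                                         ∎)
  where
  open ≡-Reasoning
  r = n ∸ suc j
  bs = replicate r true
  len : suc j + r ≡ n
  len = m+[n∸m]≡n j<n
  len′ : j + suc (length bs) ≡ n
  len′ = trans (cong (λ l → j + suc l) (length-replicate r)) (trans (+-suc j r) len)
  free≡ : replicate r free ≡ map stepConstraint bs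
  free≡ = sym (map-replicate stepConstraint r true)

allAscents : ℕ → List ℕ
allAscents k = monomialFrom 0 (replicate k true)

length-allAscents : (k : ℕ) → length (allAscents k) ≡ suc k
length-allAscents k = cong suc (trans (length-ascentsFrom 0 (replicate k true)) (length-replicate k))

coeffU-allAscents : {k : ℕ} (E : Digraph (suc k)) → coeffU E (allAscents k) ≡ suc k !
coeffU-allAscents {k} E = begin
  coeffU E (allAscents k)                              ≡⟨ coeffU-monomialFrom E (replicate k true) (cong suc (length-replicate k)) ⟩
  #listings E (map stepConstraint (replicate k true))  ≡⟨ cong (#listings E) (map-replicate stepConstraint k true) ⟩
  #listings E (replicate k free)                       ≡⟨ #listings-edgePrefix E 0 k refl ⟩
  #paths E 0 * k !                                     ≡⟨ cong (_* k !) (#paths-zero E) ⟩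
  suc k !                                              ∎
  where open ≡-Reasoning

coeffU-wrongDegree : {m : ℕ} (E : Digraph m) (mono : List ℕ) → ¬ length mono ≡ m → coeffU E mono ≡ 0
coeffU-wrongDegree {m} E mono len≢m with length mono ≡ᵇ m in len≡ᵇm
... | false = refl
... | true = ⊥-elim (len≢m (≡ᵇ⇒≡ (length mono) m (subst T (sym len≡ᵇm) tt)))

-- The monomial x₀x₁⋯x_k has coefficient (k+1)! in U_X if X has k+1 vertices, and 0 otherwise.
coeffU-allAscents⇒1+k≡m : {k m : ℕ} (X : Digraph (suc k)) (Y : Digraph m) →
  coeffU X (allAscents k) ≡ coeffU Y (allAscents k) → suc k ≡ m
coeffU-allAscents⇒1+k≡m {k} {m} X Y same-coeff with suc k ℕ.≟ m
... | yes k+1≡m = k+1≡m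
... | no k+1≢m = ⊥-elim (≢-nonZero⁻¹ (suc k !) {{suc k !≢0}} (begin
  suc k !                  ≡⟨ sym (coeffU-allAscents X) ⟩
  coeffU X (allAscents k)  ≡⟨ same-coeff ⟩
  coeffU Y (allAscents k)  ≡⟨ coeffU-wrongDegree Y (allAscents k) (k+1≢m ∘ trans (sym (length-allAscents k))) ⟩
  0                        ∎))
  where open ≡-Reasoning

SameU⇒n≡m : {n m : ℕ} (X : Digraph n) (Y : Digraph m) → SameU X Y → n ≡ m
SameU⇒n≡m {zero} {zero} X Y same = refl
SameU⇒n≡m {zero} {suc k} X Y same =
  sym (coeffU-allAscents⇒1+k≡m Y X (sym (same _ (monomialFrom-weaklyIncreasing 0 (replicate k true)))))
SameU⇒n≡m {suc k} X Y same = coeffU-allAscents⇒1+k≡m X Y (same _ (monomialFrom-weaklyIncreasing 0 (replicate k true)))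

-- Recovering a multiset of positive numbers from its truncated sums

-- A path on l vertices has l ∸ j subpaths with j edges.
excessSum : ℕ → List ℕ → ℕ
excessSum j = ∑ (_∸ j)

All≤⇒excessSum≡0 : {j : ℕ} (ls : List ℕ) → All (_≤ j) ls → excessSum j ls ≡ 0
All≤⇒excessSum≡0 [] [] = refl
All≤⇒excessSum≡0 (l ∷ ls) (l≤j ∷ ls≤j) = cong₂ _+_ (m≤n⇒m∸n≡0 l≤j) (All≤⇒excessSum≡0 ls ls≤j)

excessSum≡0⇒All≤ : {j : ℕ} (ls : List ℕ) → excessSum j ls ≡ 0 → All (_≤ j) ls
excessSum≡0⇒All≤ [] _ = []
excessSum≡0⇒All≤ {j} (l ∷ ls) eq =
  m∸n≡0⇒m≤n (m+n≡0⇒m≡0 (l ∸ j) eq) ∷ excessSum≡0⇒All≤ ls (m+n≡0⇒n≡0 (l ∸ j) eq)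

excessSum-large : {j : ℕ} (ls : List ℕ) → sum ls ≤ j → excessSum j ls ≡ 0
excessSum-large [] _ = refl
excessSum-large (l ∷ ls) l+ls≤j =
  cong₂ _+_ (m≤n⇒m∸n≡0 (≤-trans (m≤m+n l _) l+ls≤j)) (excessSum-large ls (≤-trans (m≤n+m _ l) l+ls≤j))

max∈ : (x : ℕ) (xs : List ℕ) → max x xs ∈ x ∷ xs
max∈ x xs with argmax-sel id x xs
... | inj₁ max≡x = here max≡x
... | inj₂ max∈xs = there max∈xs

≤max : (x : ℕ) (xs : List ℕ) → All (_≤ max x xs) (x ∷ xs)
≤max x xs = v≤max⁺ x xs (inj₁ ≤-refl) ∷ xs≤max x xs

max-bounded : {x y : ℕ} {xs ys : List ℕ} → (∀ j → excessSum j (x ∷ xs) ≡ excessSum j (y ∷ ys)) → max y ys ≤ max x xs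
max-bounded {x} {y} {xs} {ys} eq = All.lookup y∷ys≤M (max∈ y ys)
  where
  y∷ys≤M : All (_≤ max x xs) (y ∷ ys)
  y∷ys≤M = excessSum≡0⇒All≤ (y ∷ ys) (trans (sym (eq (max x xs))) (All≤⇒excessSum≡0 (x ∷ xs) (≤max x xs)))

-- Both lists have the same maximum M (the least j with excessSum j = 0); remove one M from each and recurse.
excessSum-injective : {ls ls′ : List ℕ} → All (0 <_) ls → All (0 <_) ls′ →
  (∀ j → excessSum j ls ≡ excessSum j ls′) → ls ↭ ls′
excessSum-injective {ls} {ls′} = by-length (length ls) ls ls′ refl
  where
  by-length : (k : ℕ) (ls ls′ : List ℕ) → length ls ≡ k → All (0 <_) ls → All (0 <_) ls′ →
    (∀ j → excessSum j ls ≡ excessSum j ls′) → ls ↭ ls′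
  by-length k [] [] _ _ _ _ = ↭-refl
  by-length k [] (y ∷ ys) _ _ (0<y ∷ _) eq with excessSum≡0⇒All≤ (y ∷ ys) (sym (eq 0))
  ... | y≤0 ∷ _ = ⊥-elim (<⇒≱ 0<y y≤0)
  by-length k (x ∷ xs) [] _ (0<x ∷ _) _ eq with excessSum≡0⇒All≤ (x ∷ xs) (eq 0)
  ... | x≤0 ∷ _ = ⊥-elim (<⇒≱ 0<x x≤0)
  by-length (suc k) (x ∷ xs) (y ∷ ys) len pos pos′ eq with ∈⇒↭∷ (max∈ x xs) | ∈⇒↭∷ M∈y∷ys
    where
    M∈y∷ys : max x xs ∈ y ∷ ys
    M∈y∷ys = subst (_∈ y ∷ ys) (≤-antisym (max-bounded {xs = xs} {ys} eq) (max-bounded {xs = ys} {xs} (sym ∘ eq)))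
                   (max∈ y ys)
  ... | rs , p | rs′ , p′ = ↭-trans p (↭-trans (↭-prep M rs↭rs′) (↭-sym p′))
    where
    M = max x xs
    rs↭rs′ : rs ↭ rs′
    rs↭rs′ = by-length k rs rs′ (suc-injective (trans (sym (↭.↭-length p)) len))
      (All.tail (↭.All-resp-↭ p pos)) (All.tail (↭.All-resp-↭ p′ pos′))
      (λ j → +-cancelˡ-≡ (M ∸ j) _ _ (trans (sym (∑-↭ (_∸ j) p)) (trans (eq j) (∑-↭ (_∸ j) p′))))

-- Digraphs given by a path cover

ConsecutiveIn : List (List (Fin n)) → Fin n → Fin n → Set
ConsecutiveIn {n} ps a b = Σ (List (Fin n)) λ p → (p ∈ ps) × Consecutive a b p

record PathCover (E : Digraph n) (ps : List (List (Fin n))) : Set where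
  field
    covers : concat ps ↭ allFin n
    edge⇒consecutive : ∀ a b → E a b ≡ true → ConsecutiveIn ps a b
    consecutive⇒edge : ∀ a b → ConsecutiveIn ps a b → E a b ≡ true

module _ {E : Digraph n} {ps : List (List (Fin n))} (cover : PathCover E ps) where

  open PathCover cover

  private
    variable
      q : List (Fin n)
      xs ys rest : List (Fin n)
      a b c : Fin n

  Unique-concat : Unique (concat ps)
  Unique-concat = Unique-resp-↭ (↭-sym covers) (allFin⁺ n)

  suffix-determined : (xs′ : List (Fin n)) {q′ rest′ : List (Fin n)} → q ∈ ps → q′ ∈ ps →
    q ≡ xs ++ a ∷ rest → q′ ≡ xs′ ++ a ∷ rest′ → rest ≡ rest′
  suffix-determined {xs = xs} xs′ q∈ps q′∈ps refl refl =
    Unique-suffix xs xs′ (Unique-concat-∈ Unique-concat q∈ps)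
      (Unique-concat-shared Unique-concat q∈ps q′∈ps (∈-insert xs) (∈-insert xs′))

  edge⇒suffix : q ∈ ps → q ≡ xs ++ a ∷ rest → E a c ≡ true → ∃ λ ys → rest ≡ c ∷ ys
  edge⇒suffix q∈ps q≡ Eac with edge⇒consecutive _ _ Eac
  ... | q′ , q′∈ps , xs′ , ys′ , q′≡ = ys′ , suffix-determined xs′ q∈ps q′∈ps q≡ q′≡

  no-edge-from-last : q ∈ ps → q ≡ xs ++ [ a ] → E a c ≡ false
  no-edge-from-last {a = a} {c = c} q∈ps q≡ with E a c in Eac
  ... | false = refl
  ... | true with edge⇒suffix q∈ps q≡ Eac
  ... | _ , ()

  walk-follows-path : (u : List (Fin n)) → q ∈ ps → q ≡ xs ++ b ∷ rest → IsWalkᵇ E (b ∷ u) ≡ true →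
    ∃ λ t → rest ≡ u ++ t
  walk-follows-path {rest = rest} [] _ _ _ = rest , refl
  walk-follows-path {xs = xs} {b} (c ∷ u) q∈ps q≡ walk with ∧-≡-true {E b c} walk
  ... | Ebc , walk′ with edge⇒suffix q∈ps q≡ Ebc
  ... | ys , refl with walk-follows-path u q∈ps (trans q≡ (sym (++-assoc xs [ b ] (c ∷ ys)))) walk′
  ... | t , refl = t , refl

  #pathsFrom-last : (j : ℕ) → q ∈ ps → q ≡ xs ++ [ a ] → #pathsFrom E (suc j) a ≡ 0
  #pathsFrom-last {a = a} j q∈ps q≡ =
    trans (∑-allLists-suc (λ u → 𝟙 (IsWalkᵇ E (a ∷ u) ∧ noDup (a ∷ u))) j)
          (∑-zero (λ c → ∑-zero (λ u → no-walk c u) (allLists n j)) (allFin n))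
    where
    no-walk : ∀ c u → 𝟙 ((E a c ∧ IsWalkᵇ E (c ∷ u)) ∧ noDup (a ∷ c ∷ u)) ≡ 0
    no-walk c u rewrite no-edge-from-last {c = c} q∈ps q≡ = refl

  -- b is the only out-neighbour of a, and a walk from b follows the path beyond a, so it never returns to a.
  #pathsFrom-next : (j : ℕ) → q ∈ ps → q ≡ xs ++ a ∷ b ∷ ys → #pathsFrom E (suc j) a ≡ #pathsFrom E j b
  #pathsFrom-next {q} {xs} {a} {b} {ys} j q∈ps q≡ = begin
    #pathsFrom E (suc j) a
      ≡⟨ ∑-allLists-suc (λ u → 𝟙 (IsWalkᵇ E (a ∷ u) ∧ noDup (a ∷ u))) j ⟩
    ∑ (λ c → ∑ (λ u → 𝟙 (IsWalkᵇ E (a ∷ c ∷ u) ∧ noDup (a ∷ c ∷ u))) (allLists n j)) (allFin n)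
      ≡⟨ ∑-allFin-single _ b only-b ⟩
    ∑ (λ u → 𝟙 (IsWalkᵇ E (a ∷ b ∷ u) ∧ noDup (a ∷ b ∷ u))) (allLists n j)
      ≡⟨ ∑-cong drop-a (allLists n j) ⟩
    #pathsFrom E j b ∎
    where
    open ≡-Reasoning
    only-b : ∀ c → ¬ c ≡ b → ∑ (λ u → 𝟙 (IsWalkᵇ E (a ∷ c ∷ u) ∧ noDup (a ∷ c ∷ u))) (allLists n j) ≡ 0
    only-b c c≢b with E a c in Eac
    ... | false = ∑-zero (λ _ → refl) (allLists n j)
    ... | true = ⊥-elim (c≢b (sym (∷-injectiveˡ (proj₂ (edge⇒suffix q∈ps q≡ Eac)))))
    a∉b∷ys : a ∉ b ∷ ys
    a∉b∷ys = Unique[x∷xs]⇒x∉xs (proj₁ (proj₂ (Unique-++⁻ xs (subst Unique q≡ (Unique-concat-∈ Unique-concat q∈ps)))))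
    drop-a : ∀ u → 𝟙 (IsWalkᵇ E (a ∷ b ∷ u) ∧ noDup (a ∷ b ∷ u)) ≡ 𝟙 (IsWalkᵇ E (b ∷ u) ∧ noDup (b ∷ u))
    drop-a u rewrite consecutive⇒edge a b (q , q∈ps , xs , ys , q≡) with IsWalkᵇ E (b ∷ u) in walk
    ... | false = refl
    ... | true with walk-follows-path u q∈ps (trans q≡ (sym (++-assoc xs [ a ] (b ∷ ys)))) walk
    ... | t , ys≡u++t
      rewrite ∉⇒elemᵇ-false (b ∷ u) (subst (λ zs → a ∉ b ∷ zs) ys≡u++t a∉b∷ys ∘ ∈-++⁺ˡ) = refl

  ∑-#pathsFrom-shift : (j : ℕ) → q ∈ ps → q ≡ xs ++ a ∷ ys →
    ∑ (#pathsFrom E (suc j)) (a ∷ ys) ≡ ∑ (#pathsFrom E j) ys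
  ∑-#pathsFrom-shift {ys = []} j q∈ps q≡ = cong (_+ 0) (#pathsFrom-last j q∈ps q≡)
  ∑-#pathsFrom-shift {xs = xs} {a} {b ∷ ys} j q∈ps q≡ =
    cong₂ _+_ (#pathsFrom-next j q∈ps q≡) (∑-#pathsFrom-shift j q∈ps (trans q≡ (sym (++-assoc xs [ a ] (b ∷ ys)))))

  ∑-#pathsFrom-suffix : (j : ℕ) (xs ys : List (Fin n)) → q ∈ ps → q ≡ xs ++ ys → ∑ (#pathsFrom E j) ys ≡ length ys ∸ j
  ∑-#pathsFrom-suffix zero xs ys _ _ = ∑-const-1 ys
  ∑-#pathsFrom-suffix (suc j) xs [] _ _ = refl
  ∑-#pathsFrom-suffix (suc j) xs (a ∷ ys) q∈ps q≡ =
    trans (∑-#pathsFrom-shift j q∈ps q≡) (∑-#pathsFrom-suffix j (xs ++ [ a ]) ys q∈ps (trans q≡ (sym (++-assoc xs [ a ] ys))))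

  #paths≡excessSum : (j : ℕ) → #paths E j ≡ excessSum j (map length ps)
  #paths≡excessSum j = begin
    #paths E j                                ≡⟨ #paths≡∑#pathsFrom E j ⟩
    ∑ (#pathsFrom E j) (allFin n)             ≡⟨ ∑-↭ (#pathsFrom E j) (↭-sym covers) ⟩
    ∑ (#pathsFrom E j) (concat ps)            ≡⟨ ∑-concat (#pathsFrom E j) ps ⟩
    ∑ (∑ (#pathsFrom E j)) ps                 ≡⟨ ∑-cong-∈ ps (λ q∈ps → ∑-#pathsFrom-suffix j [] _ q∈ps refl) ⟩
    ∑ (λ q → length q ∸ j) ps                 ≡⟨ sym (∑-map (_∸ j) length ps) ⟩
    excessSum j (map length ps)               ∎
    where open ≡-Reasoning

  sum-lengths : sum (map length ps) ≡ n
  sum-lengths = trans (sym (length-concat ps)) (trans (↭.↭-length covers) (length-tabulate id))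

SameU⇒excessSum : {X Y : Digraph n} {ps qs : List (List (Fin n))} → PathCover X ps → PathCover Y qs → SameU X Y →
  ∀ j → excessSum j (map length ps) ≡ excessSum j (map length qs)
SameU⇒excessSum {n} {ps = ps} {qs} coverX coverY same j with suc j ≤? n
... | yes j<n = trans (sym (#paths≡excessSum coverX j)) (trans (#paths-sameU same j j<n) (#paths≡excessSum coverY j))
... | no j≮n = trans (excessSum-large (map length ps) (subst (_≤ j) (sym (sum-lengths coverX)) n≤j))
                     (sym (excessSum-large (map length qs) (subst (_≤ j) (sym (sum-lengths coverY)) n≤j)))
  where
  n≤j : n ≤ j
  n≤j = ≤-pred (≰⇒> j≮n)

PathCover-↭ : {E : Digraph n} {ps qs : List (List (Fin n))} → ps ↭ qs → PathCover E ps → PathCover E qs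
PathCover-↭ ps↭qs cover = record
  { covers = ↭-trans (concat-↭ (↭-sym ps↭qs)) covers
  ; edge⇒consecutive = λ a b Eab → let (p , p∈ps , p-ab) = edge⇒consecutive a b Eab in p , ↭.∈-resp-↭ ps↭qs p∈ps , p-ab
  ; consecutive⇒edge = λ a b (p , p∈qs , p-ab) → consecutive⇒edge a b (p , ↭.∈-resp-↭ (↭-sym ps↭qs) p∈qs , p-ab)
  }
  where open PathCover cover

IsDisjointUnionOfPaths⇒PathCover : {E : Digraph n} → IsDisjointUnionOfPaths E →
  ∃ λ ps → All (0 <_) (map length ps) × PathCover E ps
IsDisjointUnionOfPaths⇒PathCover (ps , nonEmpty , covers , edge⇒consecutive , consecutive⇒edge) =
  ps , All.map⁺ (All.map (λ { (_ , _ , refl) → z<s }) nonEmpty) , record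
    { covers = covers ; edge⇒consecutive = edge⇒consecutive ; consecutive⇒edge = consecutive⇒edge }

-- Isomorphism from equal path lengths

translate : List (Fin n) → List (Fin n) → Fin n → Fin n
translate (x ∷ xs) (y ∷ ys) a with a ≟ x
... | yes _ = y
... | no _ = translate xs ys a
translate _ _ a = a

translate-head : (x : Fin n) (xs : List (Fin n)) (y : Fin n) (ys : List (Fin n)) → translate (x ∷ xs) (y ∷ ys) x ≡ y
translate-head x xs y ys with x ≟ x
... | yes _ = refl
... | no x≢x = ⊥-elim (x≢x refl)

translate-tail : {x a : Fin n} (xs : List (Fin n)) (y : Fin n) (ys : List (Fin n)) → ¬ a ≡ x →
  translate (x ∷ xs) (y ∷ ys) a ≡ translate xs ys a
translate-tail {x = x} {a} xs y ys a≢x with a ≟ x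
... | yes a≡x = ⊥-elim (a≢x a≡x)
... | no _ = refl

map-translate : (xs ys : List (Fin n)) → Unique xs → length xs ≡ length ys → map (translate xs ys) xs ≡ ys
map-translate [] [] _ _ = refl
map-translate (x ∷ xs) (y ∷ ys) (x∉xs ∷ u) len = cong₂ _∷_ (translate-head x xs y ys)
  (trans (map-cong-local (All.map (λ x≢a → translate-tail xs y ys (x≢a ∘ sym)) x∉xs))
         (map-translate xs ys u (suc-injective len)))

translate-∈ : {a : Fin n} (xs ys : List (Fin n)) → length xs ≡ length ys → a ∈ xs → translate xs ys a ∈ ys
translate-∈ {a = a} (x ∷ xs) (y ∷ ys) len a∈x∷xs with a ≟ x | a∈x∷xs
... | yes _ | _ = here refl
... | no a≢x | here a≡x = ⊥-elim (a≢x a≡x)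
... | no _ | there a∈xs = there (translate-∈ xs ys (suc-injective len) a∈xs)

translate-inverse : {a : Fin n} (xs ys : List (Fin n)) → Unique ys → length xs ≡ length ys → a ∈ xs →
  translate ys xs (translate xs ys a) ≡ a
translate-inverse {a = a} (x ∷ xs) (y ∷ ys) u len a∈x∷xs with a ≟ x | a∈x∷xs | u
... | yes a≡x | _ | _ = trans (translate-head y ys x xs) (sym a≡x)
... | no a≢x | here a≡x | _ = ⊥-elim (a≢x a≡x)
... | no _ | there a∈xs | y∉ys ∷ u′ =
  trans (translate-tail ys x xs (λ t≡y → All.lookup y∉ys (translate-∈ xs ys (suc-injective len) a∈xs) (sym t≡y)))
        (translate-inverse xs ys u′ (suc-injective len) a∈xs)

ConsecutiveIn-map : {m : ℕ} (f : Fin n → Fin m) {ps : List (List (Fin n))} {a b : Fin n} →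
  ConsecutiveIn ps a b → ConsecutiveIn (map (map f) ps) (f a) (f b)
ConsecutiveIn-map f (p , p∈ps , xs , ys , refl) = map f p , ∈-map⁺ (map f) p∈ps , map f xs , map f ys , map-++ f xs _

edge-transport : {X Y : Digraph n} {ps qs : List (List (Fin n))} (f : Fin n → Fin n) →
  PathCover X ps → PathCover Y qs → map (map f) ps ≡ qs → ∀ u v → X u v ≡ true → Y (f u) (f v) ≡ true
edge-transport f coverX coverY refl u v Xuv =
  PathCover.consecutive⇒edge coverY (f u) (f v) (ConsecutiveIn-map f (PathCover.edge⇒consecutive coverX u v Xuv))

PathCover⇒Isomorphic : {X Y : Digraph n} {ps qs : List (List (Fin n))} → PathCover X ps → PathCover Y qs →
  map length ps ≡ map length qs → Isomorphic X Y
PathCover⇒Isomorphic {n} {X} {Y} {ps} {qs} coverX coverY lens = ↔⇒⤖ (mk↔ₛ′ f g f∘g g∘f) , edges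
  where
  open PathCover
  L = concat ps
  L′ = concat qs
  length-L : length L ≡ length L′
  length-L = trans (↭.↭-length (covers coverX)) (sym (↭.↭-length (covers coverY)))
  f g : Fin n → Fin n
  f = translate L L′
  g = translate L′ L
  g∘f : ∀ a → g (f a) ≡ a
  g∘f a = translate-inverse L L′ (Unique-concat coverY) length-L (↭.∈-resp-↭ (↭-sym (covers coverX)) (∈-allFin a))
  f∘g : ∀ a → f (g a) ≡ a
  f∘g a = translate-inverse L′ L (Unique-concat coverX) (sym length-L) (↭.∈-resp-↭ (↭-sym (covers coverY)) (∈-allFin a))
  f-ps : map (map f) ps ≡ qs
  f-ps = concat-injective (map (map f) ps) qs
    (trans (sym (map-∘ ps)) (trans (map-cong (length-map f) ps) lens))
    (trans (concat-map ps) (map-translate L L′ (Unique-concat coverX) length-L))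
  g-qs : map (map g) qs ≡ ps
  g-qs = trans (cong (map (map g)) (sym f-ps)) (map-inverse (map-inverse g∘f) ps)
  edges : ∀ u v → X u v ≡ Y (f u) (f v)
  edges u v = true⇔true⇒≡ (edge-transport f coverX coverY f-ps u v)
    (subst₂ (λ a b → X a b ≡ true) (g∘f u) (g∘f v) ∘ edge-transport g coverY coverX g-qs (f u) (f v))

mainTheorem15 : (n m : ℕ) (X : Digraph n) (Y : Digraph m) →
    IsDisjointUnionOfPaths X → IsDisjointUnionOfPaths Y →
    SameU X Y → Isomorphic X Y
mainTheorem15 n m X Y hX hY same with SameU⇒n≡m X Y same
... | refl with IsDisjointUnionOfPaths⇒PathCover hX | IsDisjointUnionOfPaths⇒PathCover hY
... | ps , ps>0 , coverX | qs , qs>0 , coverY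
  with ↭.↭-map-inv length (excessSum-injective qs>0 ps>0 (sym ∘ SameU⇒excessSum coverX coverY same))
... | qs′ , lengths≡ , qs↭qs′ = PathCover⇒Isomorphic coverX (PathCover-↭ qs↭qs′ coverY) lengths≡
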